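{- Let $q$ be a prime power, $k\geq 1$, $\theta_m=\frac{q^{m+1}-1}{q-1}$, and let $\mathcal{S}$ be a set of $k$-dimensional subspaces (blocks) of $\mathrm{PG}(n,q)$ pairwise intersecting in exactly a point, which is not a sunflower. If $P$ is a point contained in some block, then $P$ lies in at most $\theta_k$ blocks, and $P$ lies on at most $\theta_k\theta_{k-1}$ lines that are contained in some block.
   Context: All dimensions are projective. A sunflower is a set of $k$-spaces pairwise meeting in exactly one point, all passing through one common point. -}

module Defs where

open import Level using (0ℓ)
open import Data.Nat as ℕ using (ℕ; zero; suc)
open import Data.Fin using (Fin) renaming (zero to fzero; suc to fsuc)
open import Data.Product using (Σ; ∃; _×_; _,_)
open import Data.List using (List; length)
open import Data.List.Relation.Unary.All using (All)
open import Data.List.Relation.Unary.AllPairs using (AllPairs)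
open import Relation.Binary.PropositionalEquality using (_≡_)
open import Relation.Nullary using (¬_)
open import Algebra.Structures using (IsCommutativeRing)
open import Function.Bundles using (_↔_)

-- Gaussian-type numbers θ_m = (q^{m+1}-1)/(q-1) = 1 + q + ... + q^m
θ : ℕ → ℕ → ℕ
θ q zero = 1
θ q (suc m) = q ℕ.^ suc m ℕ.+ θ q m

record Field : Set₁ where
  infixl 7 _*_
  infixl 6 _+_
  field
    Carrier : Set
    _+_ _*_ : Carrier → Carrier → Carrier
    -_ : Carrier → Carrier
    0# 1# : Carrier
    isCommutativeRing : IsCommutativeRing _≡_ _+_ _*_ -_ 0# 1#
    0≢1 : ¬ (0# ≡ 1#)
    inverse : ∀ x → ¬ (x ≡ 0#) → Σ Carrier λ y → x * y ≡ 1#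

record FiniteField (q : ℕ) : Set₁ where
  field
    field' : Field
  open Field field' public
  field
    enum : Carrier ↔ Fin q

module ProjectiveSpace {q : ℕ} (F : FiniteField q) (n : ℕ) where
  open FiniteField F

  Vector : Set
  Vector = Fin (suc n) → Carrier

  lincomb : {m : ℕ} → (Fin m → Carrier) → (Fin m → Vector) → Vector
  lincomb {zero} c v j = 0#
  lincomb {suc m} c v j =
    c fzero * v fzero j + lincomb (λ i → c (fsuc i)) (λ i → v (fsuc i)) j

  LinearlyIndependent : {m : ℕ} → (Fin m → Vector) → Set
  LinearlyIndependent v = ∀ c → (∀ j → lincomb c v j ≡ 0#) → ∀ i → c i ≡ 0#

  -- a projective k-space of PG(n,q): a (k+1)-dimensional vector subspace,
  -- given by a basis of k+1 linearly independent vectors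
  record Subspace (k : ℕ) : Set where
    field
      basis : Fin (suc k) → Vector
      independent : LinearlyIndependent basis

  _∈ₛ_ : {k : ℕ} → Vector → Subspace k → Set
  v ∈ₛ A = ∃ λ c → ∀ j → v j ≡ lincomb c (Subspace.basis A) j

  _⊆ₛ_ : {k l : ℕ} → Subspace k → Subspace l → Set
  A ⊆ₛ B = ∀ v → v ∈ₛ A → v ∈ₛ B

  -- equality of subspaces (as sets), independent of the chosen basis
  _≐_ : {k : ℕ} → Subspace k → Subspace k → Set
  A ≐ B = A ⊆ₛ B × B ⊆ₛ A

  Point : Set
  Point = Subspace 0

  Line : Set
  Line = Subspace 1

  MeetIn : {k l : ℕ} → Subspace k → Subspace l → Point → Set
  MeetIn A B P = ∀ v → ((v ∈ₛ A × v ∈ₛ B) → v ∈ₛ P) × (v ∈ₛ P → (v ∈ₛ A × v ∈ₛ B))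

  MeetInAPoint : {k l : ℕ} → Subspace k → Subspace l → Set
  MeetInAPoint A B = ∃ λ (P : Point) → MeetIn A B P

  -- a set of k-spaces, given as a predicate on k-spaces
  -- (invariant under change of basis)
  record SetOfSubspaces (k : ℕ) : Set₁ where
    field
      _∈S : Subspace k → Set
      resp : ∀ {A B} → A ≐ B → A ∈S → B ∈S

  PairwiseMeetInAPoint : {k : ℕ} → SetOfSubspaces k → Set
  PairwiseMeetInAPoint S = ∀ A B → A ∈S → B ∈S → ¬ (A ≐ B) → MeetInAPoint A B
    where open SetOfSubspaces S

  Sunflower : {k : ℕ} → SetOfSubspaces k → Set
  Sunflower S = PairwiseMeetInAPoint S × ∃ λ (P : Point) → ∀ A → A ∈S → P ⊆ₛ A
    where open SetOfSubspaces S

  Distinct : {k : ℕ} → List (Subspace k) → Set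
  Distinct = AllPairs (λ A B → ¬ (A ≐ B))

-- Since S is not a sunflower, some block B₀ ∈ S misses P.  This
-- is used constructively: a bound N ≤ m is decidable and so is membership in a
-- subspace over a finite field, hence it suffices to prove the bound assuming a
-- block B₀ with P ∉ B₀ (if there were none, every block would contain P).
--
-- (1) A block B ∋ P meets B₀ in a point X_B, and X_B determines B: if X_B ∈ B' for
--     another block B' ∋ P, then B ∩ B' contains both P and X_B, which forces
--     P = X_B ∈ B₀.  As B₀ has θ_k points, at most θ_k blocks pass through P.
-- (2) The lines through P inside a k-space B correspond to the points of the
--     quotient B/P, a projective (k-1)-space, so there are at most θ_{k-1} of them.
--     Coding a line through P by the code of a block containing it together with
--     its code inside a canonical block with that code bounds the lines by θ_k·θ_{k-1}.
--
-- Points of PG(m,q) are coded injectively into Fin θ_m (normalised homogeneous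
-- coordinates), and both bounds are instances of the pigeonhole principle for
-- lists of pairwise distinct elements.

module Submission where

open import Level using (0ℓ)
open import Data.Nat as ℕ using (ℕ; zero; suc; _≤_; _∸_; s≤s)
open import Data.Nat.Properties using (≰⇒>)
open import Data.Fin as Fin using (Fin; punchIn; _↑ˡ_; _↑ʳ_; combine; splitAt)
  renaming (zero to fzero; suc to fsuc)
import Data.Fin.Properties as Finₚ
open import Data.Fin.Properties using (any?; all?)
open import Data.Vec as Vec using (Vec; [])
open import Data.Vec.Properties using (lookup∘tabulate)
open import Data.Vec.Functional using (tail)
open import Data.Product using (Σ; ∃; _×_; _,_; proj₁; proj₂)
open import Data.List using (List; length; lookup)
open import Data.List.Relation.Unary.All as All using (All)
open import Data.List.Relation.Unary.AllPairs using (AllPairs; _∷_)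
open import Data.List.Membership.Propositional.Properties using (∈-lookup)
open import Data.Empty using (⊥-elim)
open import Relation.Nullary using (¬_; Dec; yes; no; ¬?)
open import Relation.Nullary.Decidable using (decidable-stable)
open import Relation.Binary.PropositionalEquality
open import Algebra.Bundles using (CommutativeRing)
open import Algebra.Structures using (IsCommutativeRing)
open import Function.Bundles using (Inverse; Injection)
open import Function.Properties.Inverse using (↔⇒↣)
open import Defs

module FieldFacts (K : Field) where
  open Field K
  open IsCommutativeRing isCommutativeRing hiding (refl; sym; trans)
  open ≡-Reasoning

  commutativeRing : CommutativeRing 0ℓ 0ℓ
  commutativeRing = record { isCommutativeRing = isCommutativeRing }

  1≢0 : ¬ (1# ≡ 0#)
  1≢0 e = 0≢1 (sym e)

  inv : (a : Carrier) → ¬ (a ≡ 0#) → Carrier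
  inv a a≢0 = proj₁ (inverse a a≢0)

  inv-inverseˡ : ∀ a (a≢0 : ¬ (a ≡ 0#)) → inv a a≢0 * a ≡ 1#
  inv-inverseˡ a a≢0 = trans (*-comm _ _) (proj₂ (inverse a a≢0))

  inv-cancelˡ : ∀ a (a≢0 : ¬ (a ≡ 0#)) z → inv a a≢0 * (a * z) ≡ z
  inv-cancelˡ a a≢0 z = begin
    inv a a≢0 * (a * z)  ≡⟨ sym (*-assoc _ _ _) ⟩
    inv a a≢0 * a * z    ≡⟨ cong (_* z) (inv-inverseˡ a a≢0) ⟩
    1# * z               ≡⟨ *-identityˡ z ⟩
    z                    ∎

  inv-cancelʳ : ∀ a (a≢0 : ¬ (a ≡ 0#)) z → a * (inv a a≢0 * z) ≡ z
  inv-cancelʳ a a≢0 z = begin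
    a * (inv a a≢0 * z)  ≡⟨ sym (*-assoc _ _ _) ⟩
    a * inv a a≢0 * z    ≡⟨ cong (_* z) (proj₂ (inverse a a≢0)) ⟩
    1# * z               ≡⟨ *-identityˡ z ⟩
    z                    ∎

  inv-rescale : ∀ a (a≢0 : ¬ (a ≡ 0#)) x → x * inv a a≢0 * a ≡ x
  inv-rescale a a≢0 x = begin
    x * inv a a≢0 * a    ≡⟨ *-assoc _ _ _ ⟩
    x * (inv a a≢0 * a)  ≡⟨ cong (x *_) (inv-inverseˡ a a≢0) ⟩
    x * 1#               ≡⟨ *-identityʳ x ⟩
    x                    ∎

  *-cancel-nonzero : ∀ a b → ¬ (a ≡ 0#) → a * b ≡ 0# → b ≡ 0#
  *-cancel-nonzero a b a≢0 ab≡0 = begin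
    b                    ≡⟨ sym (inv-cancelˡ a a≢0 b) ⟩
    inv a a≢0 * (a * b)  ≡⟨ cong (inv a a≢0 *_) ab≡0 ⟩
    inv a a≢0 * 0#       ≡⟨ zeroʳ _ ⟩
    0#                   ∎

  IsZero : ∀ {m} → (Fin m → Carrier) → Set
  IsZero u = ∀ i → u i ≡ 0#

  tail-nonzero : ∀ {m} {c : Fin (suc m) → Carrier} → ¬ IsZero c → c fzero ≡ 0# → ¬ IsZero (tail c)
  tail-nonzero c≢0 c₀≡0 tail≡0 = c≢0 λ { fzero → c₀≡0 ; (fsuc i) → tail≡0 i }

  Multiple : ∀ {m} → (Fin m → Carrier) → (Fin m → Carrier) → Set
  Multiple u v = Σ Carrier λ a → ∀ i → v i ≡ a * u i

  multiple-trans : ∀ {m} {u v w : Fin m → Carrier} → Multiple u v → Multiple v w → Multiple u w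
  multiple-trans {u = u} {v} {w} (a , v≡au) (b , w≡bv) = b * a , λ i → begin
    w i            ≡⟨ w≡bv i ⟩
    b * v i        ≡⟨ cong (b *_) (v≡au i) ⟩
    b * (a * u i)  ≡⟨ sym (*-assoc b a (u i)) ⟩
    b * a * u i    ∎

  multiple-invert : ∀ {m} {u v : Fin m → Carrier} ((a , _) : Multiple u v) → ¬ (a ≡ 0#) → Multiple v u
  multiple-invert {u = u} {v} (a , v≡au) a≢0 =
    inv a a≢0 , λ i → trans (sym (inv-cancelˡ a a≢0 (u i))) (cong (inv a a≢0 *_) (sym (v≡au i)))

  multiple-nonzero : ∀ {m} {u v : Fin m → Carrier} ((a , _) : Multiple u v) → ¬ IsZero v → ¬ (a ≡ 0#)
  multiple-nonzero {u = u} (a , v≡au) v≢0 a≡0 =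
    v≢0 λ i → trans (v≡au i) (trans (cong (_* u i) a≡0) (zeroˡ (u i)))

module ProjectiveCoordinates {q : ℕ} (F : FiniteField q) where
  open FiniteField F
  open FieldFacts field'
  open IsCommutativeRing isCommutativeRing hiding (refl; sym; trans)
  open ≡-Reasoning

  code : Carrier → Fin q
  code = Inverse.to enum

  code-injective : ∀ {x y} → code x ≡ code y → x ≡ y
  code-injective = Injection.injective (↔⇒↣ enum)

  _≟_ : (x y : Carrier) → Dec (x ≡ y)
  _≟_ = Finₚ.inj⇒≟ (↔⇒↣ enum)

  nonzero-entry : ∀ {m} (c : Fin m → Carrier) → ¬ IsZero c → ∃ λ i → ¬ (c i ≡ 0#)
  nonzero-entry c c≢0 = decidable-stable (any? λ i → ¬? (c i ≟ 0#)) λ none →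
    c≢0 λ i → decidable-stable (c i ≟ 0#) λ cᵢ≢0 → none (i , cᵢ≢0)

  Searchable : Set → Set₁
  Searchable A = (P : A → Set) → (∀ x → Dec (P x)) → Dec (∃ P)

  search-Carrier : Searchable Carrier
  search-Carrier P P? with any? (λ i → P? (Inverse.from enum i))
  ... | yes (i , p) = yes (Inverse.from enum i , p)
  ... | no none = no λ { (x , p) → none (code x , subst P (sym (Inverse.strictlyInverseʳ enum x)) p) }

  search-Vec : ∀ m → Searchable (Vec Carrier m)
  search-Vec zero P P? with P? []
  ... | yes p = yes ([] , p)
  ... | no ¬p = no λ { ([] , p) → ¬p p }
  search-Vec (suc m) P P?
    with search-Carrier (λ x → ∃ λ xs → P (x Vec.∷ xs))
                        (λ x → search-Vec m (λ xs → P (x Vec.∷ xs)) (λ xs → P? (x Vec.∷ xs)))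
  ... | yes (x , xs , p) = yes (x Vec.∷ xs , p)
  ... | no none = no λ { (x Vec.∷ xs , p) → none (x , xs , p) }

  digits : ∀ {r} → (Fin r → Carrier) → Fin (q ℕ.^ r)
  digits {zero}  _ = fzero
  digits {suc r} v = combine (code (v fzero)) (digits (tail v))

  digits-split : ∀ {r} (v w : Fin (suc r) → Carrier) → digits v ≡ digits w →
                 code (v fzero) ≡ code (w fzero) × digits (tail v) ≡ digits (tail w)
  digits-split v w = Finₚ.combine-injective (code (v fzero)) (digits (tail v)) (code (w fzero)) (digits (tail w))

  digits-injective : ∀ {r} (v w : Fin r → Carrier) → digits v ≡ digits w → ∀ i → v i ≡ w i
  digits-injective {suc r} v w e fzero    = code-injective (proj₁ (digits-split v w e))
  digits-injective {suc r} v w e (fsuc i) = digits-injective (tail v) (tail w) (proj₂ (digits-split v w e)) i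

  ↑ˡ≢↑ʳ : ∀ {a b} (i : Fin a) (j : Fin b) → ¬ (i ↑ˡ b ≡ a ↑ʳ j)
  ↑ˡ≢↑ʳ {a} {b} i j e with trans (sym (Finₚ.splitAt-↑ˡ a i b)) (trans (cong (splitAt a) e) (Finₚ.splitAt-↑ʳ a b j))
  ... | ()

  -- θ_{m+1} = q^{m+1} + θ_m: a tuple with nonzero first entry c₀ is coded by the
  -- digits of its tail scaled by c₀⁻¹, a tuple with c₀ = 0 by the code of its tail.
  pointCode : ∀ {m} → (Fin (suc m) → Carrier) → Fin (θ q m)
  pointCode {zero}  c = fzero
  pointCode {suc m} c with c fzero ≟ 0#
  ... | yes _   = (q ℕ.^ suc m) ↑ʳ pointCode (tail c)
  ... | no c₀≢0 = digits (λ i → inv (c fzero) c₀≢0 * tail c i) ↑ˡ θ q m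

  pointCode-multiple : ∀ {m} (c c' : Fin (suc m) → Carrier) → ¬ IsZero c → ¬ IsZero c' →
                       pointCode c ≡ pointCode c' → Multiple c c'
  pointCode-multiple {zero} c c' c≢0 _ _ =
    c' fzero * inv (c fzero) c₀≢0 , λ { fzero → sym (inv-rescale (c fzero) c₀≢0 (c' fzero)) }
    where
      c₀≢0 : ¬ (c fzero ≡ 0#)
      c₀≢0 c₀≡0 = c≢0 λ { fzero → c₀≡0 }
  pointCode-multiple {suc m} c c' c≢0 c'≢0 e with c fzero ≟ 0# | c' fzero ≟ 0#
  ... | yes c₀≡0 | yes c'₀≡0
    with pointCode-multiple (tail c) (tail c') (tail-nonzero c≢0 c₀≡0) (tail-nonzero c'≢0 c'₀≡0)
                            (Finₚ.↑ʳ-injective _ _ _ e)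
  ... | a , tail≡ = a , λ { fzero → trans c'₀≡0 (sym (trans (cong (a *_) c₀≡0) (zeroʳ a)))
                          ; (fsuc i) → tail≡ i }
  pointCode-multiple {suc m} c c' c≢0 c'≢0 e | yes _ | no _ = ⊥-elim (↑ˡ≢↑ʳ _ _ (sym e))
  pointCode-multiple {suc m} c c' c≢0 c'≢0 e | no _ | yes _ = ⊥-elim (↑ˡ≢↑ʳ _ _ e)
  pointCode-multiple {suc m} c c' c≢0 c'≢0 e | no c₀≢0 | no c'₀≢0 =
    c'₀ * c₀⁻¹ , λ { fzero → sym (inv-rescale (c fzero) c₀≢0 c'₀) ; (fsuc i) → tail≡ i }
    where
      c₀⁻¹ c'₀ : Carrier
      c₀⁻¹ = inv (c fzero) c₀≢0
      c'₀ = c' fzero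
      same-digits : ∀ i → c₀⁻¹ * c (fsuc i) ≡ inv c'₀ c'₀≢0 * c' (fsuc i)
      same-digits = digits-injective _ _ (Finₚ.↑ˡ-injective _ _ _ e)
      tail≡ : ∀ i → c' (fsuc i) ≡ c'₀ * c₀⁻¹ * c (fsuc i)
      tail≡ i = begin
        c' (fsuc i)                         ≡⟨ sym (inv-cancelʳ c'₀ c'₀≢0 _) ⟩
        c'₀ * (inv c'₀ c'₀≢0 * c' (fsuc i)) ≡⟨ cong (c'₀ *_) (sym (same-digits i)) ⟩
        c'₀ * (c₀⁻¹ * c (fsuc i))           ≡⟨ sym (*-assoc _ _ _) ⟩
        c'₀ * c₀⁻¹ * c (fsuc i)             ∎

module Subspaces {q : ℕ} (F : FiniteField q) (n : ℕ) where
  open ProjectiveSpace F n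
  open FiniteField F
  open FieldFacts field'
  open ProjectiveCoordinates F
  open IsCommutativeRing isCommutativeRing hiding (refl; sym; trans)
  open import Algebra.Properties.Ring (CommutativeRing.ring commutativeRing) using (-‿distribˡ-*)
  open import Algebra.Properties.AbelianGroup (CommutativeRing.+-abelianGroup commutativeRing) using (⁻¹-∙-comm)
  open import Algebra.Properties.CommutativeSemigroup (CommutativeRing.+-commutativeSemigroup commutativeRing)
    using (interchange)
  open import Algebra.Properties.Group (CommutativeRing.+-group commutativeRing)
    using (x∙y⁻¹≈ε⇒x≈y; ε⁻¹≈ε; //-rightDividesʳ)
  open ≡-Reasoning

  lincomb-cong : ∀ {m} (c d : Fin m → Carrier) (v : Fin m → Vector) → (∀ i → c i ≡ d i) →
                 ∀ j → lincomb c v j ≡ lincomb d v j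
  lincomb-cong {zero}  c d v c≡d j = refl
  lincomb-cong {suc m} c d v c≡d j =
    cong₂ _+_ (cong (_* v fzero j) (c≡d fzero)) (lincomb-cong (tail c) (tail d) (tail v) (λ i → c≡d (fsuc i)) j)

  lincomb-scale : ∀ {m} a (c : Fin m → Carrier) (v : Fin m → Vector) →
                  ∀ j → lincomb (λ i → a * c i) v j ≡ a * lincomb c v j
  lincomb-scale {zero}  a c v j = sym (zeroʳ a)
  lincomb-scale {suc m} a c v j = begin
    a * c fzero * v fzero j + lincomb (λ i → a * tail c i) (tail v) j
      ≡⟨ cong₂ _+_ (*-assoc _ _ _) (lincomb-scale a (tail c) (tail v) j) ⟩
    a * (c fzero * v fzero j) + a * lincomb (tail c) (tail v) j
      ≡⟨ sym (distribˡ a _ _) ⟩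
    a * lincomb c v j
      ∎

  lincomb-add : ∀ {m} (c d : Fin m → Carrier) (v : Fin m → Vector) →
                ∀ j → lincomb (λ i → c i + d i) v j ≡ lincomb c v j + lincomb d v j
  lincomb-add {zero}  c d v j = sym (+-identityˡ 0#)
  lincomb-add {suc m} c d v j = begin
    (c fzero + d fzero) * v fzero j + lincomb (λ i → tail c i + tail d i) (tail v) j
      ≡⟨ cong₂ _+_ (distribʳ (v fzero j) (c fzero) (d fzero)) (lincomb-add (tail c) (tail d) (tail v) j) ⟩
    (c fzero * v fzero j + d fzero * v fzero j) + (lincomb (tail c) (tail v) j + lincomb (tail d) (tail v) j)
      ≡⟨ interchange _ _ _ _ ⟩
    lincomb c v j + lincomb d v j
      ∎

  lincomb-neg : ∀ {m} (c : Fin m → Carrier) (v : Fin m → Vector) →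
                ∀ j → lincomb (λ i → - c i) v j ≡ - lincomb c v j
  lincomb-neg {zero}  c v j = sym ε⁻¹≈ε
  lincomb-neg {suc m} c v j =
    trans (cong₂ _+_ (sym (-‿distribˡ-* (c fzero) (v fzero j))) (lincomb-neg (tail c) (tail v) j))
          (⁻¹-∙-comm _ _)

  lincomb-zero : ∀ {m} (c : Fin m → Carrier) (v : Fin m → Vector) → IsZero c → ∀ j → lincomb c v j ≡ 0#
  lincomb-zero {zero}  c v c≡0 j = refl
  lincomb-zero {suc m} c v c≡0 j = begin
    c fzero * v fzero j + lincomb (tail c) (tail v) j
      ≡⟨ cong₂ _+_ (cong (_* v fzero j) (c≡0 fzero)) (lincomb-zero (tail c) (tail v) (λ i → c≡0 (fsuc i)) j) ⟩
    0# * v fzero j + 0#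
      ≡⟨ trans (+-identityʳ _) (zeroˡ _) ⟩
    0#
      ∎

  lincomb-injective : ∀ {m} (c d : Fin m → Carrier) (v : Fin m → Vector) → LinearlyIndependent v →
                      (∀ j → lincomb c v j ≡ lincomb d v j) → ∀ i → c i ≡ d i
  lincomb-injective c d v independent c≡d i = x∙y⁻¹≈ε⇒x≈y _ _ (independent (λ i → c i + - d i) difference≡0 i)
    where
      difference≡0 : ∀ j → lincomb (λ i → c i + - d i) v j ≡ 0#
      difference≡0 j = begin
        lincomb (λ i → c i + - d i) v j            ≡⟨ lincomb-add c (λ i → - d i) v j ⟩
        lincomb c v j + lincomb (λ i → - d i) v j  ≡⟨ cong₂ _+_ (c≡d j) (lincomb-neg d v j) ⟩
        lincomb d v j + - lincomb d v j            ≡⟨ -‿inverseʳ _ ⟩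
        0#                                         ∎

  represented-multiple : ∀ {m} {u u' : Vector} {c c' : Fin m → Carrier} (v : Fin m → Vector) →
                         (∀ j → u j ≡ lincomb c v j) → (∀ j → u' j ≡ lincomb c' v j) →
                         Multiple c c' → Multiple u u'
  represented-multiple {u = u} {u'} {c} {c'} v u≡ u'≡ (a , c'≡ac) = a , λ j → begin
    u' j                         ≡⟨ u'≡ j ⟩
    lincomb c' v j               ≡⟨ lincomb-cong c' _ v c'≡ac j ⟩
    lincomb (λ i → a * c i) v j  ≡⟨ lincomb-scale a c v j ⟩
    a * lincomb c v j            ≡⟨ cong (a *_) (sym (u≡ j)) ⟩
    a * u j                      ∎

  represented-nonzero : ∀ {m} {u : Vector} {c : Fin m → Carrier} (v : Fin m → Vector) →
                        (∀ j → u j ≡ lincomb c v j) → ¬ IsZero u → ¬ IsZero c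
  represented-nonzero v u≡ u≢0 c≡0 = u≢0 λ j → trans (u≡ j) (lincomb-zero _ v c≡0 j)

  unit : ∀ {m} → Fin m → Fin m → Carrier
  unit fzero    fzero    = 1#
  unit fzero    (fsuc _) = 0#
  unit (fsuc i) fzero    = 0#
  unit (fsuc i) (fsuc l) = unit i l

  unit-diagonal : ∀ {m} (i : Fin m) → unit i i ≡ 1#
  unit-diagonal fzero    = refl
  unit-diagonal (fsuc i) = unit-diagonal i

  lincomb-unit : ∀ {m} (i : Fin m) (v : Fin m → Vector) → ∀ j → lincomb (unit i) v j ≡ v i j
  lincomb-unit fzero v j =
    trans (cong₂ _+_ (*-identityˡ _) (lincomb-zero (λ _ → 0#) (tail v) (λ _ → refl) j)) (+-identityʳ _)
  lincomb-unit (fsuc i) v j =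
    trans (cong (_+ lincomb (unit i) (tail v) j) (zeroˡ _)) (trans (+-identityˡ _) (lincomb-unit i (tail v) j))

  ∈-resp : ∀ {k} (A : Subspace k) {v w : Vector} → (∀ j → v j ≡ w j) → v ∈ₛ A → w ∈ₛ A
  ∈-resp A v≡w (c , v≡) = c , λ j → trans (sym (v≡w j)) (v≡ j)

  ∈-multiple : ∀ {k} (A : Subspace k) {u v : Vector} → Multiple u v → u ∈ₛ A → v ∈ₛ A
  ∈-multiple A (a , v≡au) (c , u≡) =
    (λ i → a * c i) , λ j → trans (v≡au j) (trans (cong (a *_) (u≡ j)) (sym (lincomb-scale a c (Subspace.basis A) j)))

  ∈-scale : ∀ {k} (A : Subspace k) a {v : Vector} → v ∈ₛ A → (λ j → a * v j) ∈ₛ A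
  ∈-scale A a = ∈-multiple A (a , λ j → refl)

  ∈-add : ∀ {k} (A : Subspace k) {v w : Vector} → v ∈ₛ A → w ∈ₛ A → (λ j → v j + w j) ∈ₛ A
  ∈-add A (c , v≡) (d , w≡) =
    (λ i → c i + d i) , λ j → trans (cong₂ _+_ (v≡ j) (w≡ j)) (sym (lincomb-add c d (Subspace.basis A) j))

  ∈-cancel : ∀ {k} (A : Subspace k) a {u v : Vector} → (λ j → u j + a * v j) ∈ₛ A → v ∈ₛ A → u ∈ₛ A
  ∈-cancel A a {u} {v} u+av∈A v∈A = ∈-resp A u+av-av≡u (∈-add A u+av∈A (∈-scale A (- a) v∈A))
    where
      u+av-av≡u : ∀ j → u j + a * v j + - a * v j ≡ u j
      u+av-av≡u j = trans (cong (u j + a * v j +_) (sym (-‿distribˡ-* a (v j)))) (//-rightDividesʳ _ _)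

  lincomb-∈ : ∀ {k m} (A : Subspace k) (c : Fin m → Carrier) (v : Fin m → Vector) →
              (∀ i → v i ∈ₛ A) → (λ j → lincomb c v j) ∈ₛ A
  lincomb-∈ {m = zero}  A c v v∈A = (λ _ → 0#) , λ j → sym (lincomb-zero _ (Subspace.basis A) (λ _ → refl) j)
  lincomb-∈ {m = suc m} A c v v∈A =
    ∈-add A (∈-scale A (c fzero) (v∈A fzero)) (lincomb-∈ A (tail c) (tail v) (λ i → v∈A (fsuc i)))

  basis-∈ : ∀ {k} (A : Subspace k) (i : Fin (suc k)) → Subspace.basis A i ∈ₛ A
  basis-∈ A i = unit i , λ j → sym (lincomb-unit i (Subspace.basis A) j)

  basis-nonzero : ∀ {k} (A : Subspace k) (i : Fin (suc k)) → ¬ IsZero (Subspace.basis A i)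
  basis-nonzero A i bᵢ≡0 =
    1≢0 (trans (sym (unit-diagonal i))
               (Subspace.independent A (unit i) (λ j → trans (lincomb-unit i (Subspace.basis A) j) (bᵢ≡0 j)) i))

  basis⊆ : ∀ {k l} (A : Subspace k) (B : Subspace l) → (∀ i → Subspace.basis A i ∈ₛ B) → A ⊆ₛ B
  basis⊆ A B basis∈B v (c , v≡) = ∈-resp B (λ j → sym (v≡ j)) (lincomb-∈ B c (Subspace.basis A) basis∈B)

  point : Point → Vector
  point P = Subspace.basis P fzero

  point-∈ : (P : Point) → point P ∈ₛ P
  point-∈ P = basis-∈ P fzero

  point-nonzero : (P : Point) → ¬ IsZero (point P)
  point-nonzero P = basis-nonzero P fzero

  ∈point⇒multiple : (P : Point) {v : Vector} → v ∈ₛ P → Multiple (point P) v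
  ∈point⇒multiple P (c , v≡) = c fzero , λ j → trans (v≡ j) (+-identityʳ _)

  point⊆ : ∀ {k} (P : Point) (A : Subspace k) → point P ∈ₛ A → P ⊆ₛ A
  point⊆ P A p∈A = basis⊆ P A λ { fzero → p∈A }

  line-lincomb : (L : Line) (c : Fin 2 → Carrier) → ∀ j →
                 lincomb c (Subspace.basis L) j
                   ≡ c fzero * Subspace.basis L fzero j + c (fsuc fzero) * Subspace.basis L (fsuc fzero) j
  line-lincomb L c j = cong (c fzero * Subspace.basis L fzero j +_) (+-identityʳ _)

  _∈?_ : ∀ {k} (v : Vector) (A : Subspace k) → Dec (v ∈ₛ A)
  _∈?_ {k} v A with search-Vec (suc k) (λ c → ∀ j → v j ≡ lincomb (Vec.lookup c) (Subspace.basis A) j)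
                                     (λ c → all? (λ j → v j ≟ lincomb (Vec.lookup c) (Subspace.basis A) j))
  ... | yes (c , v≡) = yes (Vec.lookup c , v≡)
  ... | no none = no λ { (c , v≡) → none (Vec.tabulate c , λ j →
          trans (v≡ j) (lincomb-cong c _ (Subspace.basis A) (λ i → sym (lookup∘tabulate c i)) j)) }

  -- Coordinates of v in A (meaningful when v ∈ A); opaque, so that the
  -- exhaustive search behind it is never unfolded during type checking.
  opaque
    coords : ∀ {k} (v : Vector) (A : Subspace k) → Fin (suc k) → Carrier
    coords v A with v ∈? A
    ... | yes (c , _) = c
    ... | no _ = λ _ → 0#

    coords-correct : ∀ {k} (v : Vector) (A : Subspace k) → v ∈ₛ A →
                     ∀ j → v j ≡ lincomb (coords v A) (Subspace.basis A) j
    coords-correct v A v∈A with v ∈? A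
    ... | yes (c , v≡) = v≡
    ... | no v∉A = ⊥-elim (v∉A v∈A)

module Pigeonhole {A : Set} (R : A → A → Set) where

  AllPairs-lookup : ∀ {xs : List A} → AllPairs R xs → ∀ i j → i Fin.< j → R (lookup xs i) (lookup xs j)
  AllPairs-lookup (Rx ∷ _)   fzero    (fsuc j) _         = All.lookup Rx (∈-lookup j)
  AllPairs-lookup (_ ∷ Rxs) (fsuc i) (fsuc j) (s≤s i<j) = AllPairs-lookup Rxs i j i<j

  pigeonhole : (xs : List A) → AllPairs R xs → ∀ {m} (f : Fin (length xs) → Fin m) →
               (∀ i j → f i ≡ f j → ¬ R (lookup xs i) (lookup xs j)) → length xs ≤ m
  pigeonhole xs pairwise {m} f separates = decidable-stable (length xs ℕ.≤? m) λ length≰m →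
    let (i , j , i<j , fᵢ≡fⱼ) = Finₚ.pigeonhole (≰⇒> length≰m) f
    in separates i j fᵢ≡fⱼ (AllPairs-lookup pairwise i j i<j)

  canonical : ∀ {N a} (f : Fin N → Fin a) (c : Fin a) (d : Fin N) → Fin N
  canonical f c d with any? (λ r → f r Finₚ.≟ c)
  ... | yes (r , _) = r
  ... | no _ = d

  canonical-spec : ∀ {N a} (f : Fin N → Fin a) (c : Fin a) (i : Fin N) → f i ≡ c →
                   ∀ d d' → f (canonical f c d) ≡ c × canonical f c d ≡ canonical f c d'
  canonical-spec f c i fᵢ≡c d d' with any? (λ r → f r Finₚ.≟ c)
  ... | yes (r , fᵣ≡c) = fᵣ≡c , refl
  ... | no none = ⊥-elim (none (i , fᵢ≡c))

  -- Coding i by (f i, g (canonical representative of its fibre) i) gives the bound a·b.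
  pigeonhole-fibred : (xs : List A) → AllPairs R xs → ∀ {a b} (f : Fin (length xs) → Fin a)
                      (g : Fin (length xs) → Fin (length xs) → Fin b) →
                      (∀ r i j → f i ≡ f r → f j ≡ f r → g r i ≡ g r j → ¬ R (lookup xs i) (lookup xs j)) →
                      length xs ≤ a ℕ.* b
  pigeonhole-fibred xs pairwise {a} {b} f g separates = pigeonhole xs pairwise code code-separates
    where
      representative : Fin (length xs) → Fin (length xs)
      representative i = canonical f (f i) i

      representative-fibre : ∀ i → f (representative i) ≡ f i
      representative-fibre i = proj₁ (canonical-spec f (f i) i refl i i)

      representative-same : ∀ i j → f i ≡ f j → representative j ≡ representative i
      representative-same i j fᵢ≡fⱼ =
        trans (cong (λ c → canonical f c j) (sym fᵢ≡fⱼ)) (proj₂ (canonical-spec f (f i) i refl j i))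

      code : Fin (length xs) → Fin (a ℕ.* b)
      code i = combine (f i) (g (representative i) i)

      code-separates : ∀ i j → code i ≡ code j → ¬ R (lookup xs i) (lookup xs j)
      code-separates i j codeᵢ≡codeⱼ
        with Finₚ.combine-injective (f i) (g (representative i) i) (f j) (g (representative j) j) codeᵢ≡codeⱼ
      ... | fᵢ≡fⱼ , gᵢ≡gⱼ =
        separates (representative i) i j (sym (representative-fibre i))
                  (trans (sym fᵢ≡fⱼ) (sym (representative-fibre i)))
                  (trans gᵢ≡gⱼ (cong (λ r → g r j) (representative-same i j fᵢ≡fⱼ)))

punchIn-ext : ∀ {A : Set} {m} (t : Fin (suc m)) (u v : Fin (suc m) → A) → u t ≡ v t →
              (∀ j → u (punchIn t j) ≡ v (punchIn t j)) → ∀ i → u i ≡ v i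
punchIn-ext t u v uₜ≡vₜ off i with t Finₚ.≟ i
... | yes refl = uₜ≡vₜ
... | no t≢i   =
  trans (cong u (sym (Finₚ.punchIn-punchOut t≢i))) (trans (off _) (cong v (Finₚ.punchIn-punchOut t≢i)))

module Counting {q : ℕ} (F : FiniteField q) (n : ℕ) where
  open ProjectiveSpace F n
  open FiniteField F
  open FieldFacts field'
  open ProjectiveCoordinates F
  open Subspaces F n
  open IsCommutativeRing isCommutativeRing hiding (refl; sym; trans)
  open import Algebra.Properties.Ring (CommutativeRing.ring commutativeRing) using (-‿distribˡ-*)
  open import Algebra.Properties.Group (CommutativeRing.+-group commutativeRing) using (inverseˡ-unique)
  open ≡-Reasoning

  meet-multiple : ∀ {k l} (A : Subspace k) (B : Subspace l) → MeetInAPoint A B →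
                  ∀ {u v} → u ∈ₛ A → u ∈ₛ B → ¬ IsZero u → v ∈ₛ A → v ∈ₛ B → Multiple u v
  meet-multiple A B (Q , meet) {u} u∈A u∈B u≢0 v∈A v∈B =
    multiple-trans (multiple-invert u-on-Q (multiple-nonzero u-on-Q u≢0)) (on-Q v∈A v∈B)
    where
      on-Q : ∀ {w} → w ∈ₛ A → w ∈ₛ B → Multiple (point Q) w
      on-Q {w} w∈A w∈B = ∈point⇒multiple Q (proj₁ (meet w) (w∈A , w∈B))
      u-on-Q : Multiple (point Q) u
      u-on-Q = on-Q u∈A u∈B

  module BlocksThroughPoint {k} (S : SetOfSubspaces k) (pairwise : PairwiseMeetInAPoint S) (P : Point)
                            (B₀ : Subspace k) (B₀∈S : SetOfSubspaces._∈S S B₀) (P∉B₀ : ¬ (point P ∈ₛ B₀)) where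
    open SetOfSubspaces S

    p : Vector
    p = point P

    meet-B₀ : ∀ B → B ∈S → p ∈ₛ B → MeetInAPoint B B₀
    meet-B₀ B B∈S p∈B = pairwise B B₀ B∈S B₀∈S λ B≐B₀ → P∉B₀ (proj₁ B≐B₀ p p∈B)

    meetPoint : ∀ B → B ∈S → p ∈ₛ B → Point
    meetPoint B B∈S p∈B = proj₁ (meet-B₀ B B∈S p∈B)

    meetVector : ∀ B → B ∈S → p ∈ₛ B → Vector
    meetVector B B∈S p∈B = point (meetPoint B B∈S p∈B)

    meetVector-∈ : ∀ B (B∈S : B ∈S) (p∈B : p ∈ₛ B) →
                   meetVector B B∈S p∈B ∈ₛ B × meetVector B B∈S p∈B ∈ₛ B₀
    meetVector-∈ B B∈S p∈B =
      proj₂ (proj₂ (meet-B₀ B B∈S p∈B) (meetVector B B∈S p∈B)) (point-∈ (meetPoint B B∈S p∈B))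

    meetCoords : ∀ B → B ∈S → p ∈ₛ B → Fin (suc k) → Carrier
    meetCoords B B∈S p∈B = proj₁ (proj₂ (meetVector-∈ B B∈S p∈B))

    meetCoords-correct : ∀ B (B∈S : B ∈S) (p∈B : p ∈ₛ B) →
                         ∀ j → meetVector B B∈S p∈B j ≡ lincomb (meetCoords B B∈S p∈B) (Subspace.basis B₀) j
    meetCoords-correct B B∈S p∈B = proj₂ (proj₂ (meetVector-∈ B B∈S p∈B))

    meetCoords-nonzero : ∀ B (B∈S : B ∈S) (p∈B : p ∈ₛ B) → ¬ IsZero (meetCoords B B∈S p∈B)
    meetCoords-nonzero B B∈S p∈B =
      represented-nonzero (Subspace.basis B₀) (meetCoords-correct B B∈S p∈B) (point-nonzero (meetPoint B B∈S p∈B))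

    -- The code of a block through P is the code of X_B as a point of B₀ ≅ PG(k,q).
    blockCode : ∀ B → B ∈S → p ∈ₛ B → Fin (θ q k)
    blockCode B B∈S p∈B = pointCode (meetCoords B B∈S p∈B)

    -- X_B lies on no other block B' through P: otherwise P and X_B both lie in the
    -- single point B ∩ B', so p is a multiple of X_B and lies in B₀.
    meetVector-determines-block : ∀ B B' (B∈S : B ∈S) (B'∈S : B' ∈S) (p∈B : p ∈ₛ B) → p ∈ₛ B' →
                                  meetVector B B∈S p∈B ∈ₛ B' → ¬ ¬ (B ≐ B')
    meetVector-determines-block B B' B∈S B'∈S p∈B p∈B' x∈B' B≉B' =
      P∉B₀ (∈-multiple B₀ (meet-multiple B B' (pairwise B B' B∈S B'∈S B≉B') x∈B x∈B' x≢0 p∈B p∈B') x∈B₀)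
      where
        x∈B : meetVector B B∈S p∈B ∈ₛ B
        x∈B = proj₁ (meetVector-∈ B B∈S p∈B)
        x∈B₀ : meetVector B B∈S p∈B ∈ₛ B₀
        x∈B₀ = proj₂ (meetVector-∈ B B∈S p∈B)
        x≢0 : ¬ IsZero (meetVector B B∈S p∈B)
        x≢0 = point-nonzero (meetPoint B B∈S p∈B)

    blockCode-injective : ∀ B B' (B∈S : B ∈S) (B'∈S : B' ∈S) (p∈B : p ∈ₛ B) (p∈B' : p ∈ₛ B') →
                          blockCode B B∈S p∈B ≡ blockCode B' B'∈S p∈B' → ¬ ¬ (B ≐ B')
    blockCode-injective B B' B∈S B'∈S p∈B p∈B' same =
      meetVector-determines-block B B' B∈S B'∈S p∈B p∈B'
        (∈-multiple B' X_B'-to-X_B (proj₁ (meetVector-∈ B' B'∈S p∈B')))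
      where
        X_B'-to-X_B : Multiple (meetVector B' B'∈S p∈B') (meetVector B B∈S p∈B)
        X_B'-to-X_B =
          represented-multiple (Subspace.basis B₀) (meetCoords-correct B' B'∈S p∈B') (meetCoords-correct B B∈S p∈B)
            (pointCode-multiple _ _ (meetCoords-nonzero B' B'∈S p∈B') (meetCoords-nonzero B B∈S p∈B) (sym same))

  -- The lines through P inside a (k+1)-space B ∋ P are the points of the quotient B/P.
  -- With a the coordinates of p in B and a_t ≠ 0, a line L ∋ P is represented by a
  -- second point y of L; reducing the coordinates d of y to d - (d_t/a_t)·a and
  -- dropping the vanishing entry t leaves a nonzero (k+1)-tuple determined by L up to
  -- a scalar, whose point code is the code of L.
  module LinesThroughPoint {k} (B : Subspace (suc k)) (P : Point) (p∈B : point P ∈ₛ B) where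

    p : Vector
    p = point P

    a : Fin (suc (suc k)) → Carrier
    a = proj₁ p∈B

    a-correct : ∀ j → p j ≡ lincomb a (Subspace.basis B) j
    a-correct = proj₂ p∈B

    pivot : ∃ λ t → ¬ (a t ≡ 0#)
    pivot = nonzero-entry a (represented-nonzero (Subspace.basis B) a-correct (point-nonzero P))

    t : Fin (suc (suc k))
    t = proj₁ pivot

    pc : Line → Fin 2 → Carrier
    pc L = coords p L

    pc-correct : ∀ L → P ⊆ₛ L →
                 ∀ j → p j ≡ pc L fzero * Subspace.basis L fzero j + pc L (fsuc fzero) * Subspace.basis L (fsuc fzero) j
    pc-correct L P⊆L j = trans (coords-correct p L (P⊆L p (point-∈ P)) j) (line-lincomb L (pc L) j)

    -- A second point of L: the basis vector b₁ of L, unless p has a b₁-component, then b₀.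
    secondIndex : Line → Fin 2
    secondIndex L with pc L (fsuc fzero) ≟ 0#
    ... | yes _ = fsuc fzero
    ... | no _  = fzero

    secondPoint : Line → Vector
    secondPoint L = Subspace.basis L (secondIndex L)

    secondPoint-∈ : ∀ L → secondPoint L ∈ₛ L
    secondPoint-∈ L = basis-∈ L (secondIndex L)

    basis-multiple-coords : ∀ L → P ⊆ₛ L → ∀ μ s → (∀ j → Subspace.basis L s j ≡ μ * p j) →
                            ∀ i → unit s i ≡ μ * pc L i
    basis-multiple-coords L P⊆L μ s bₛ≡μp =
      lincomb-injective (unit s) (λ i → μ * pc L i) (Subspace.basis L) (Subspace.independent L) λ j → begin
        lincomb (unit s) (Subspace.basis L) j            ≡⟨ lincomb-unit s (Subspace.basis L) j ⟩
        Subspace.basis L s j                             ≡⟨ bₛ≡μp j ⟩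
        μ * p j                                          ≡⟨ cong (μ *_) (coords-correct p L (P⊆L p (point-∈ P)) j) ⟩
        μ * lincomb (pc L) (Subspace.basis L) j          ≡⟨ sym (lincomb-scale μ (pc L) (Subspace.basis L) j) ⟩
        lincomb (λ i → μ * pc L i) (Subspace.basis L) j  ∎

    secondPoint-notMultiple : ∀ L → P ⊆ₛ L → ¬ Multiple p (secondPoint L)
    secondPoint-notMultiple L P⊆L (μ , y≡μp)
      with pc L (fsuc fzero) ≟ 0# | basis-multiple-coords L P⊆L μ (secondIndex L) y≡μp
    ... | yes pc₁≡0 | unit≡ = 1≢0 (trans (unit≡ (fsuc fzero)) (trans (cong (μ *_) pc₁≡0) (zeroʳ μ)))
    ... | no pc₁≢0  | unit≡ = 1≢0 (trans (unit≡ fzero) (trans (cong (_* pc L fzero) μ≡0) (zeroˡ _)))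
      where
        μ≡0 : μ ≡ 0#
        μ≡0 = *-cancel-nonzero _ μ pc₁≢0 (trans (*-comm _ _) (sym (unit≡ (fsuc fzero))))

    spannedBy : ∀ {l} (L : Line) (A : Subspace l) → P ⊆ₛ L → secondPoint L ∈ₛ A → p ∈ₛ A → L ⊆ₛ A
    spannedBy L A P⊆L y∈A p∈A with pc L (fsuc fzero) ≟ 0#
    ... | yes pc₁≡0 = basis⊆ L A λ { fzero → b₀∈A ; (fsuc fzero) → y∈A }
      where
        p≡αb₀ : Multiple (Subspace.basis L fzero) p
        p≡αb₀ = pc L fzero , λ j → trans (pc-correct L P⊆L j)
          (trans (cong (pc L fzero * Subspace.basis L fzero j +_) (trans (cong (_* _) pc₁≡0) (zeroˡ _))) (+-identityʳ _))
        b₀∈A : Subspace.basis L fzero ∈ₛ A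
        b₀∈A = ∈-multiple A (multiple-invert p≡αb₀ (multiple-nonzero p≡αb₀ (point-nonzero P))) p∈A
    ... | no pc₁≢0 = basis⊆ L A λ { fzero → y∈A ; (fsuc fzero) → b₁∈A }
      where
        βb₁∈A : (λ j → pc L (fsuc fzero) * Subspace.basis L (fsuc fzero) j) ∈ₛ A
        βb₁∈A = ∈-cancel A (pc L fzero) (∈-resp A (λ j → trans (pc-correct L P⊆L j) (+-comm _ _)) p∈A) y∈A
        b₁∈A : Subspace.basis L (fsuc fzero) ∈ₛ A
        b₁∈A = ∈-multiple A (multiple-invert (pc L (fsuc fzero) , λ j → refl) pc₁≢0) βb₁∈A

    d : Line → Fin (suc (suc k)) → Carrier
    d L = coords (secondPoint L) B

    m : Line → Carrier
    m L = - (d L t * inv (a t) (proj₂ pivot))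

    reduced : Line → Fin (suc (suc k)) → Carrier
    reduced L i = d L i + m L * a i

    lineCoords : Line → Fin (suc k) → Carrier
    lineCoords L j = reduced L (punchIn t j)

    lineCode : Line → Fin (θ q k)
    lineCode L = pointCode (lineCoords L)

    module _ (L : Line) (P⊆L : P ⊆ₛ L) (L⊆B : L ⊆ₛ B) where
      reduced-correct : ∀ j → secondPoint L j + m L * p j ≡ lincomb (reduced L) (Subspace.basis B) j
      reduced-correct j = begin
        secondPoint L j + m L * p j
          ≡⟨ cong₂ _+_ (coords-correct (secondPoint L) B (L⊆B _ (secondPoint-∈ L)) j) (cong (m L *_) (a-correct j)) ⟩
        lincomb (d L) (Subspace.basis B) j + m L * lincomb a (Subspace.basis B) j
          ≡⟨ cong (lincomb (d L) (Subspace.basis B) j +_) (sym (lincomb-scale (m L) a (Subspace.basis B) j)) ⟩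
        lincomb (d L) (Subspace.basis B) j + lincomb (λ i → m L * a i) (Subspace.basis B) j
          ≡⟨ sym (lincomb-add (d L) (λ i → m L * a i) (Subspace.basis B) j) ⟩
        lincomb (reduced L) (Subspace.basis B) j
          ∎

      reduced-pivot : reduced L t ≡ 0#
      reduced-pivot = begin
        d L t + - (d L t * a⁻¹) * a t  ≡⟨ cong (d L t +_) (sym (-‿distribˡ-* _ _)) ⟩
        d L t + - (d L t * a⁻¹ * a t)  ≡⟨ cong (λ z → d L t + - z) (inv-rescale (a t) (proj₂ pivot) (d L t)) ⟩
        d L t + - d L t                ≡⟨ -‿inverseʳ _ ⟩
        0#                             ∎
        where
          a⁻¹ : Carrier
          a⁻¹ = inv (a t) (proj₂ pivot)

      -- If the code tuple vanished, y + m·p = 0 would make y a multiple of p.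
      lineCoords-nonzero : ¬ IsZero (lineCoords L)
      lineCoords-nonzero lineCoords≡0 = secondPoint-notMultiple L P⊆L (- m L , y≡-mp)
        where
          reduced≡0 : IsZero (reduced L)
          reduced≡0 = punchIn-ext t (reduced L) (λ _ → 0#) reduced-pivot lineCoords≡0
          y+mp≡0 : ∀ j → secondPoint L j + m L * p j ≡ 0#
          y+mp≡0 j = trans (reduced-correct j) (lincomb-zero (reduced L) (Subspace.basis B) reduced≡0 j)
          y≡-mp : ∀ j → secondPoint L j ≡ - m L * p j
          y≡-mp j = trans (inverseˡ-unique _ _ (y+mp≡0 j)) (-‿distribˡ-* (m L) (p j))

    lineCode-included : ∀ L L' → P ⊆ₛ L → L ⊆ₛ B → P ⊆ₛ L' → L' ⊆ₛ B →
                        lineCode L ≡ lineCode L' → L' ⊆ₛ L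
    lineCode-included L L' P⊆L L⊆B P⊆L' L'⊆B same = spannedBy L' L P⊆L' y'∈L p∈L
      where
        p∈L : p ∈ₛ L
        p∈L = P⊆L p (point-∈ P)
        codes-multiple : Multiple (lineCoords L) (lineCoords L')
        codes-multiple =
          pointCode-multiple _ _ (lineCoords-nonzero L P⊆L L⊆B) (lineCoords-nonzero L' P⊆L' L'⊆B) same
        ν : Carrier
        ν = proj₁ codes-multiple
        reduced-multiple : Multiple (reduced L) (reduced L')
        reduced-multiple = ν , punchIn-ext t (reduced L') (λ i → ν * reduced L i)
          (trans (reduced-pivot L' P⊆L' L'⊆B) (sym (trans (cong (ν *_) (reduced-pivot L P⊆L L⊆B)) (zeroʳ ν))))
          (proj₂ codes-multiple)
        shifted-multiple : Multiple (λ j → secondPoint L j + m L * p j) (λ j → secondPoint L' j + m L' * p j)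
        shifted-multiple = represented-multiple (Subspace.basis B)
          (reduced-correct L P⊆L L⊆B) (reduced-correct L' P⊆L' L'⊆B) reduced-multiple
        y'∈L : secondPoint L' ∈ₛ L
        y'∈L = ∈-cancel L (m L')
          (∈-multiple L shifted-multiple (∈-add L (secondPoint-∈ L) (∈-scale L (m L) p∈L))) p∈L

    lineCode-injective : ∀ L L' → P ⊆ₛ L → L ⊆ₛ B → P ⊆ₛ L' → L' ⊆ₛ B →
                         lineCode L ≡ lineCode L' → L ≐ L'
    lineCode-injective L L' P⊆L L⊆B P⊆L' L'⊆B same =
      lineCode-included L' L P⊆L' L'⊆B P⊆L L⊆B (sym same) , lineCode-included L L' P⊆L L⊆B P⊆L' L'⊆B same

  blocksThroughPoint-bound :
    ∀ {k} (S : SetOfSubspaces k) → PairwiseMeetInAPoint S → (P : Point) →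
    ∀ B₀ → SetOfSubspaces._∈S S B₀ → ¬ (point P ∈ₛ B₀) →
    (Bs : List (Subspace k)) → Distinct Bs → All (λ B → SetOfSubspaces._∈S S B × P ⊆ₛ B) Bs →
    length Bs ≤ θ q k
  blocksThroughPoint-bound {k} S pairwise P B₀ B₀∈S P∉B₀ Bs distinct through =
    pigeonhole Bs distinct blockCodeᵢ λ i j →
      blockCode-injective (lookup Bs i) (lookup Bs j) (Bᵢ∈S i) (Bᵢ∈S j) (p∈Bᵢ i) (p∈Bᵢ j)
    where
      open BlocksThroughPoint S pairwise P B₀ B₀∈S P∉B₀
      open Pigeonhole (λ A B → ¬ (A ≐ B))
      Bᵢ∈S : ∀ i → SetOfSubspaces._∈S S (lookup Bs i)
      Bᵢ∈S i = proj₁ (All.lookup through (∈-lookup i))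
      p∈Bᵢ : ∀ i → p ∈ₛ lookup Bs i
      p∈Bᵢ i = proj₂ (All.lookup through (∈-lookup i)) p (point-∈ P)
      blockCodeᵢ : Fin (length Bs) → Fin (θ q k)
      blockCodeᵢ i = blockCode (lookup Bs i) (Bᵢ∈S i) (p∈Bᵢ i)

  linesThroughPoint-bound :
    ∀ {k} (S : SetOfSubspaces (suc k)) → PairwiseMeetInAPoint S → (P : Point) →
    ∀ B₀ → SetOfSubspaces._∈S S B₀ → ¬ (point P ∈ₛ B₀) →
    (Ls : List Line) → Distinct Ls →
    All (λ L → P ⊆ₛ L × ∃ λ (B : Subspace (suc k)) → SetOfSubspaces._∈S S B × L ⊆ₛ B) Ls →
    length Ls ≤ θ q (suc k) ℕ.* θ q k
  linesThroughPoint-bound {k} S pairwise P B₀ B₀∈S P∉B₀ Ls distinct through =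
    pigeonhole-fibred Ls distinct blockCodeᵢ lineCodeᵢ separates
    where
      open BlocksThroughPoint S pairwise P B₀ B₀∈S P∉B₀
      open Pigeonhole (λ A B → ¬ (A ≐ B))
      Lᵢ : Fin (length Ls) → Line
      Lᵢ = lookup Ls
      P⊆Lᵢ : ∀ i → P ⊆ₛ Lᵢ i
      P⊆Lᵢ i = proj₁ (All.lookup through (∈-lookup i))
      Bᵢ : Fin (length Ls) → Subspace (suc k)
      Bᵢ i = proj₁ (proj₂ (All.lookup through (∈-lookup i)))
      Bᵢ∈S : ∀ i → SetOfSubspaces._∈S S (Bᵢ i)
      Bᵢ∈S i = proj₁ (proj₂ (proj₂ (All.lookup through (∈-lookup i))))
      Lᵢ⊆Bᵢ : ∀ i → Lᵢ i ⊆ₛ Bᵢ i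
      Lᵢ⊆Bᵢ i = proj₂ (proj₂ (proj₂ (All.lookup through (∈-lookup i))))
      p∈Bᵢ : ∀ i → p ∈ₛ Bᵢ i
      p∈Bᵢ i = Lᵢ⊆Bᵢ i p (P⊆Lᵢ i p (point-∈ P))
      blockCodeᵢ : Fin (length Ls) → Fin (θ q (suc k))
      blockCodeᵢ i = blockCode (Bᵢ i) (Bᵢ∈S i) (p∈Bᵢ i)
      lineCodeᵢ : Fin (length Ls) → Fin (length Ls) → Fin (θ q k)
      lineCodeᵢ r i = LinesThroughPoint.lineCode (Bᵢ r) P (p∈Bᵢ r) (Lᵢ i)
      Lᵢ-in-Bᵣ : ∀ i r → blockCodeᵢ i ≡ blockCodeᵢ r → ¬ ¬ (Lᵢ i ⊆ₛ Bᵢ r)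
      Lᵢ-in-Bᵣ i r same Lᵢ⊈Bᵣ =
        blockCode-injective (Bᵢ i) (Bᵢ r) (Bᵢ∈S i) (Bᵢ∈S r) (p∈Bᵢ i) (p∈Bᵢ r) same
        λ Bᵢ≐Bᵣ → Lᵢ⊈Bᵣ λ v v∈Lᵢ → proj₁ Bᵢ≐Bᵣ v (Lᵢ⊆Bᵢ i v v∈Lᵢ)
      separates : ∀ r i j → blockCodeᵢ i ≡ blockCodeᵢ r → blockCodeᵢ j ≡ blockCodeᵢ r →
                  lineCodeᵢ r i ≡ lineCodeᵢ r j → ¬ ¬ (Lᵢ i ≐ Lᵢ j)
      separates r i j i~r j~r same Lᵢ≉Lⱼ =
        Lᵢ-in-Bᵣ i r i~r λ Lᵢ⊆Bᵣ → Lᵢ-in-Bᵣ j r j~r λ Lⱼ⊆Bᵣ →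
        Lᵢ≉Lⱼ (LinesThroughPoint.lineCode-injective (Bᵢ r) P (p∈Bᵢ r) (Lᵢ i) (Lᵢ j)
                 (P⊆Lᵢ i) Lᵢ⊆Bᵣ (P⊆Lᵢ j) Lⱼ⊆Bᵣ same)

  -- A bound N ≤ m follows once it holds whenever some block misses P: if no block
  -- missed P, every block would contain P and S would be a sunflower.
  avoidingBlock-suffices :
    ∀ {k} (S : SetOfSubspaces k) → PairwiseMeetInAPoint S → ¬ Sunflower S → (P : Point) → ∀ {N m} →
    (∀ B₀ → SetOfSubspaces._∈S S B₀ → ¬ (point P ∈ₛ B₀) → N ≤ m) → N ≤ m
  avoidingBlock-suffices S pairwise notSunflower P {N} {m} bound =
    decidable-stable (N ℕ.≤? m) λ N≰m → notSunflower (pairwise , P , λ B B∈S →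
      point⊆ P B (decidable-stable (point P ∈? B) λ P∉B → N≰m (bound B B∈S P∉B)))

open import Data.Nat using (_*_)

-- Writing k = 1 + k' (so θ_{k-1} = θ_{k'}), the two counts are bounds (1) and (2),
-- each reduced by avoidingBlock-suffices to the case of a block missing P.
mainTheorem4 : (q : ℕ) (F : FiniteField q) (n k : ℕ) → 1 ≤ k →
    let open ProjectiveSpace F n in
    (S : SetOfSubspaces k) →
    PairwiseMeetInAPoint S →
    ¬ Sunflower S →
    (P : Point) →
    (∃ λ (B : Subspace k) → SetOfSubspaces._∈S S B × P ⊆ₛ B) →
    ((Bs : List (Subspace k)) → Distinct Bs →
       All (λ B → SetOfSubspaces._∈S S B × P ⊆ₛ B) Bs →
       length Bs ≤ θ q k)
    ×
    ((Ls : List Line) → Distinct Ls →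
       All (λ L → P ⊆ₛ L × ∃ λ (B : Subspace k) → SetOfSubspaces._∈S S B × L ⊆ₛ B) Ls →
       length Ls ≤ θ q k * θ q (k ∸ 1))
mainTheorem4 q F n (suc k') (s≤s _) S pairwise notSunflower P _ =
    (λ Bs distinct through → suffices λ B₀ B₀∈S P∉B₀ →
       blocksThroughPoint-bound S pairwise P B₀ B₀∈S P∉B₀ Bs distinct through)
  , (λ Ls distinct through → suffices λ B₀ B₀∈S P∉B₀ →
       linesThroughPoint-bound S pairwise P B₀ B₀∈S P∉B₀ Ls distinct through)
  where
    open ProjectiveSpace F n
    open Subspaces F n using (point)
    open Counting F n
    suffices : ∀ {N m} → (∀ B₀ → SetOfSubspaces._∈S S B₀ → ¬ (point P ∈ₛ B₀) → N ≤ m) → N ≤ m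
    suffices = avoidingBlock-suffices S pairwise notSunflower P
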